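{- Let $a$ and $b$ be two incomparable Turing degrees. Then the problems $w_a$ and $w_b$ are incomparable with respect to $\le_W$, i.e., neither $w_a\le_W w_b$ nor $w_b\le_W w_a$.
   Context: A problem is a partial multivalued function $f:\subseteq \mathbb{N}^\mathbb{N} \rightrightarrows \mathbb{N}^\mathbb{N}$. Fix a standard computable pairing $\langle x,y\rangle$. $f \le_W g$ iff there are partial computable $h,k:\subseteq\mathbb{N}^\mathbb{N}\to\mathbb{N}^\mathbb{N}$ such that for every $x\in\mathrm{dom}(f)$, $k(x)\in\mathrm{dom}(g)$ and for every $y\in g(k(x))$, $h(\langle x,y\rangle)\in f(x)$. For a non-zero Turing degree $a$, the problem $w_a:\mathbb{N}^\mathbb{N}\rightrightarrows\mathbb{N}^\mathbb{N}$ is defined by: if $x$ is computable, $w_a(x)$ is the set of all non-computable $y\in\mathbb{N}^\mathbb{N}$; if $x$ is non-computable, $w_a(x)$ is the set of all $y\in\mathbb{N}^\mathbb{N}$ of Turing degree $a$. -}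

module Defs where

open import Data.Nat using (ℕ; zero; suc; _<_; _*_; _+_)
open import Data.Fin using (Fin)
open import Data.Vec using (Vec; []; _∷_; lookup)
open import Data.Product using (Σ; _×_; _,_)
open import Relation.Nullary using (¬_)

Baire : Set
Baire = ℕ → ℕ

-- Oracle partial recursive (μ-recursive) functions: a code of arity n
-- denotes a partial functional  Baire × ℕⁿ ⇀ ℕ  (the Baire argument is the oracle).
data Code : ℕ → Set where
  zer  : ∀ {n} → Code n
  sucC : Code 1
  proj : ∀ {n} → Fin n → Code n
  orc  : Code 1
  comp : ∀ {m n} → Code m → Vec (Code n) m → Code n
  prec : ∀ {n} → Code n → Code (suc (suc n)) → Code (suc n)
  mu   : ∀ {n} → Code (suc n) → Code n

-- Big-step evaluation: Eval c x args v  means  Φ_c^x(args) ↓ = v.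
mutual
  data Eval : ∀ {n} → Code n → Baire → Vec ℕ n → ℕ → Set where
    e-zer  : ∀ {n x} {as : Vec ℕ n} → Eval zer x as 0
    e-suc  : ∀ {x k} → Eval sucC x (k ∷ []) (suc k)
    e-proj : ∀ {n x} {as : Vec ℕ n} (i : Fin n) → Eval (proj i) x as (lookup as i)
    e-orc  : ∀ {x k} → Eval orc x (k ∷ []) (x k)
    e-comp : ∀ {m n x} {f : Code m} {gs : Vec (Code n) m} {as : Vec ℕ n} {bs : Vec ℕ m} {v : ℕ} →
             EvalVec gs x as bs → Eval f x bs v → Eval (comp f gs) x as v
    e-prec0 : ∀ {n x} {g : Code n} {h : Code (suc (suc n))} {as : Vec ℕ n} {v : ℕ} →
              Eval g x as v → Eval (prec g h) x (0 ∷ as) v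
    e-precS : ∀ {n x} {g : Code n} {h : Code (suc (suc n))} {as : Vec ℕ n} {k u v : ℕ} →
              Eval (prec g h) x (k ∷ as) u → Eval h x (k ∷ u ∷ as) v →
              Eval (prec g h) x (suc k ∷ as) v
    e-mu   : ∀ {n x} {f : Code (suc n)} {as : Vec ℕ n} {m : ℕ} →
             Eval f x (m ∷ as) 0 →
             (∀ i → i < m → Σ ℕ (λ u → Eval f x (i ∷ as) (suc u))) →
             Eval (mu f) x as m

  data EvalVec : ∀ {m n} → Vec (Code n) m → Baire → Vec ℕ n → Vec ℕ m → Set where
    ev-[] : ∀ {n x} {as : Vec ℕ n} → EvalVec [] x as []
    ev-∷  : ∀ {m n x} {g : Code n} {gs : Vec (Code n) m} {as : Vec ℕ n} {b : ℕ} {bs : Vec ℕ m} →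
            Eval g x as b → EvalVec gs x as bs → EvalVec (g ∷ gs) x as (b ∷ bs)

_⟦_⟧≃_ : Code 1 → Baire → Baire → Set
c ⟦ x ⟧≃ y = ∀ n → Eval c x (n ∷ []) (y n)

_≤T_ : Baire → Baire → Set
y ≤T x = Σ (Code 1) (λ c → c ⟦ x ⟧≃ y)

_≡T_ : Baire → Baire → Set
y ≡T x = (y ≤T x) × (x ≤T y)

Computable : Baire → Set
Computable y = y ≤T (λ _ → 0)

-- standard pairing on Baire space: ⟨x,y⟩(2n) = x(n), ⟨x,y⟩(2n+1) = y(n)
half : ℕ → ℕ
half zero = zero
half (suc zero) = zero
half (suc (suc n)) = suc (half n)

parity : ℕ → ℕ
parity zero = 0
parity (suc zero) = 1
parity (suc (suc m)) = parity m

pair : Baire → Baire → Baire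
pair x y n with parity n
... | zero = x (half n)
... | suc _ = y (half n)

-- A problem (partial multivalued function) with domain all of Baire space,
-- given as its graph: P x y  means  y ∈ P(x).
Problem : Set₁
Problem = Baire → Baire → Set

-- Weihrauch reducibility f ≤_W g for total-domain problems.
_≤W_ : Problem → Problem → Set
f ≤W g = Σ (Code 1) (λ k → Σ (Code 1) (λ h →
           ∀ x → Σ Baire (λ z → (k ⟦ x ⟧≃ z) ×
             (∀ y → g z y → Σ Baire (λ v → (h ⟦ pair x y ⟧≃ v) × f x v)))))

-- w_a, for a degree a given by a representative A
w : Baire → Problem
w A x y = (Computable x → ¬ Computable y) × (¬ Computable x → y ≡T A)

-- Feed the reduction w_A ≤W w_B the input B, which is not computable. B itself is a
-- valid w_B-answer to whatever instance k(B) is produced: it is non-computable and of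
-- degree B. The backward functional then turns ⟨B,B⟩ into an answer to w_A(B), i.e.
-- into a sequence of degree A, so A ≤T ⟨B,B⟩ ≤T B.
{-# OPTIONS --safe #-}
module Submission where

open import Defs
open import Data.Nat using (ℕ; zero; suc; _+_)
open import Data.Nat.Properties using (+-suc)
open import Data.Fin using () renaming (zero to fz; suc to fs)
open import Data.Vec using (Vec; []; _∷_)
open import Data.Product using (_×_; Σ; _,_; proj₂)
open import Relation.Nullary using (¬_)
open import Relation.Binary.PropositionalEquality using (_≡_; refl; subst; sym)

-- Replacing every oracle query by a call to c relativises a code from y to x
-- whenever c computes y from x.
mutual
  substOracle : ∀ {n} → Code 1 → Code n → Code n
  substOracle c zer         = zer
  substOracle c sucC        = sucC
  substOracle c (proj i)    = proj i
  substOracle c orc         = c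
  substOracle c (comp f gs) = comp (substOracle c f) (substOracleVec c gs)
  substOracle c (prec g h)  = prec (substOracle c g) (substOracle c h)
  substOracle c (mu f)      = mu (substOracle c f)

  substOracleVec : ∀ {m n} → Code 1 → Vec (Code n) m → Vec (Code n) m
  substOracleVec c []       = []
  substOracleVec c (g ∷ gs) = substOracle c g ∷ substOracleVec c gs

mutual
  eval-substOracle : ∀ {n x y c} {d : Code n} {as v} →
                     c ⟦ x ⟧≃ y → Eval d y as v → Eval (substOracle c d) x as v
  eval-substOracle ec e-zer            = e-zer
  eval-substOracle ec e-suc            = e-suc
  eval-substOracle ec (e-proj i)       = e-proj i
  eval-substOracle ec (e-orc {k = k})  = ec k
  eval-substOracle ec (e-comp evs e)   = e-comp (evalVec-substOracle ec evs) (eval-substOracle ec e)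
  eval-substOracle ec (e-prec0 e)      = e-prec0 (eval-substOracle ec e)
  eval-substOracle ec (e-precS e e′)   = e-precS (eval-substOracle ec e) (eval-substOracle ec e′)
  eval-substOracle ec (e-mu e below)   = e-mu (eval-substOracle ec e) (λ i i<m → positive-substOracle ec (below i i<m))

  positive-substOracle : ∀ {n x y c} {d : Code n} {as} → c ⟦ x ⟧≃ y →
                         Σ ℕ (λ u → Eval d y as (suc u)) →
                         Σ ℕ (λ u → Eval (substOracle c d) x as (suc u))
  positive-substOracle ec (u , e) = u , eval-substOracle ec e

  evalVec-substOracle : ∀ {m n x y c} {gs : Vec (Code n) m} {as bs} →
                        c ⟦ x ⟧≃ y → EvalVec gs y as bs → EvalVec (substOracleVec c gs) x as bs
  evalVec-substOracle ec ev-[]        = ev-[]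
  evalVec-substOracle ec (ev-∷ e evs) = ev-∷ (eval-substOracle ec e) (evalVec-substOracle ec evs)

≤T-refl : ∀ {x} → x ≤T x
≤T-refl = orc , λ _ → e-orc

≤T-trans : ∀ {x y z} → x ≤T y → y ≤T z → x ≤T z
≤T-trans (d , ed) (c , ec) = substOracle c d , λ n → eval-substOracle ec (ed n)

computable⇒≤T : ∀ {x} y → Computable x → x ≤T y
computable⇒≤T y cx = ≤T-trans cx (zer , λ _ → e-zer)

¬≤T⇒¬computable : ∀ {x y} → ¬ (x ≤T y) → ¬ Computable x
¬≤T⇒¬computable {y = y} x≰y cx = x≰y (computable⇒≤T y cx)

isZero : ℕ → ℕ
isZero zero    = 1
isZero (suc _) = 0

isZeroC : Code 1
isZeroC = prec (comp sucC (zer ∷ [])) zer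

eval-isZeroC : ∀ {x} k → Eval isZeroC x (k ∷ []) (isZero k)
eval-isZeroC zero    = e-prec0 (e-comp (ev-∷ e-zer ev-[]) e-suc)
eval-isZeroC (suc k) = e-precS (eval-isZeroC k) e-zer

parity-suc : ∀ k → parity (suc k) ≡ isZero (parity k)
parity-suc zero          = refl
parity-suc (suc zero)    = refl
parity-suc (suc (suc k)) = parity-suc k

parityC : Code 1
parityC = prec zer (comp isZeroC (proj (fs fz) ∷ []))

eval-parityC : ∀ {x} k → Eval parityC x (k ∷ []) (parity k)
eval-parityC zero        = e-prec0 e-zer
eval-parityC {x} (suc k) = subst (Eval parityC x (suc k ∷ [])) (sym (parity-suc k))
  (e-precS (eval-parityC k) (e-comp (ev-∷ (e-proj (fs fz)) ev-[]) (eval-isZeroC (parity k))))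

addC : Code 2
addC = prec (proj fz) (comp sucC (proj (fs fz) ∷ []))

eval-addC : ∀ {x} a b → Eval addC x (a ∷ b ∷ []) (a + b)
eval-addC zero    b = e-prec0 (e-proj fz)
eval-addC (suc a) b = e-precS (eval-addC a b) (e-comp (ev-∷ (e-proj (fs fz)) ev-[]) e-suc)

half-suc : ∀ k → half (suc k) ≡ parity k + half k
half-suc zero          = refl
half-suc (suc zero)    = refl
half-suc (suc (suc k)) rewrite half-suc k = sym (+-suc (parity k) (half k))

halfC : Code 1
halfC = prec zer (comp addC (comp parityC (proj fz ∷ []) ∷ proj (fs fz) ∷ []))

eval-halfC : ∀ {x} k → Eval halfC x (k ∷ []) (half k)
eval-halfC zero        = e-prec0 e-zer
eval-halfC {x} (suc k) = subst (Eval halfC x (suc k ∷ [])) (sym (half-suc k))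
  (e-precS (eval-halfC k)
    (e-comp (ev-∷ (e-comp (ev-∷ (e-proj fz) ev-[]) (eval-parityC k)) (ev-∷ (e-proj (fs fz)) ev-[]))
            (eval-addC (parity k) (half k))))

pair-diagonal : ∀ x n → pair x x n ≡ x (half n)
pair-diagonal x n with parity n
... | zero  = refl
... | suc _ = refl

pair-diagonal-≤T : ∀ x → pair x x ≤T x
pair-diagonal-≤T x = comp orc (halfC ∷ []) , λ n →
  subst (Eval (comp orc (halfC ∷ [])) x (n ∷ [])) (sym (pair-diagonal x n))
    (e-comp (ev-∷ (eval-halfC n) ev-[]) e-orc)

w-self-answer : ∀ {B} z → ¬ Computable B → w B z B
w-self-answer z B-nc = (λ _ → B-nc) , (λ _ → ≤T-refl , ≤T-refl)

w-≤W⇒≤T : ∀ {A B} → ¬ Computable B → w A ≤W w B → A ≤T B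
w-≤W⇒≤T {A} {B} B-nc (_ , h , reduction) with reduction B
... | z , _ , backward with backward B (w-self-answer z B-nc)
... | v , hv , (_ , v-degree) =
  ≤T-trans (proj₂ (v-degree B-nc)) (≤T-trans (h , hv) (pair-diagonal-≤T B))

lemma2p2 : (A B : Baire) → ¬ (A ≤T B) → ¬ (B ≤T A) →
    ¬ (w A ≤W w B) × ¬ (w B ≤W w A)
lemma2p2 A B A≰B B≰A =
    (λ A≤WB → A≰B (w-≤W⇒≤T (¬≤T⇒¬computable B≰A) A≤WB))
  , (λ B≤WA → B≰A (w-≤W⇒≤T (¬≤T⇒¬computable A≰B) B≤WA))
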